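{- The class $\{K_e(cp(n)) : n \in \mathbb{N}\}$ of edge-clique graphs of cocktail party graphs has unbounded rankwidth; that is, there is no constant $k$ such that $K_e(cp(n))$ has rankwidth at most $k$ for all $n$.
   Context: The cocktail party graph $cp(n)$ is the complement of a perfect matching on $2n$ vertices. For a graph $G$, the edge-clique graph $K_e(G)$ has as its vertices the edges of $G$, and two distinct vertices of $K_e(G)$ are adjacent when the corresponding edges of $G$ are contained in a common clique of $G$. Rankwidth is the standard graph width parameter of Oum and Seymour: the minimum over all subcubic trees whose leaves are in bijection with the vertices, of the maximum over tree edges of the $\mathrm{GF}(2)$-rank of the adjacency submatrix between the two sides of the induced vertex bipartition. -}

module Defs where

open import Data.Bool using (Bool; true; false; not; T)
open import Data.Nat using (ℕ; suc) renaming (_<_ to _<ℕ_)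
open import Data.Fin using (Fin; toℕ; _≟_)
open import Data.Product using (Σ; ∃; _×_; _,_)
open import Data.Sum using (_⊎_)
open import Data.Empty using (⊥)
open import Data.List using (List; []; _∷_; _++_; length)
open import Data.List.Membership.Propositional using (_∈_; _∉_)
open import Data.List.Relation.Unary.All using (All)
open import Data.List.Relation.Unary.Unique.Propositional using (Unique)
open import Data.List.Relation.Binary.Sublist.Propositional using (_⊆_)
open import Relation.Nullary using (¬_)
open import Relation.Nullary.Decidable using (⌊_⌋)
open import Relation.Binary.PropositionalEquality using (_≡_; _≢_)

record Graph : Set₁ where
  field
    V   : Set
    _~_ : V → V → Set

open Graph public

-- Cocktail party graph cp(n): vertices Fin n × Bool (2n vertices);
-- (i , a) and (j , b) adjacent iff i ≠ j, i.e. the complement of the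
-- perfect matching {(i , false) , (i , true)}.  Adjacency is stated via
-- the Boolean test so that its proofs are unique.

cp : ℕ → Graph
cp n = record
  { V   = Fin n × Bool
  ; _~_ = λ { (i , a) (j , b) → T (not ⌊ i ≟ j ⌋) }
  }

-- strict lexicographic order on the vertices of cp(n), used only to pick
-- one representative ordered pair for each (unordered) edge
_<cp_ : ∀ {n} → Fin n × Bool → Fin n × Bool → Set
(i , a) <cp (j , b) = (toℕ i <ℕ toℕ j) ⊎ ((i ≡ j) × (a ≡ false) × (b ≡ true))

-- Edge-clique graph K_e(G), given a strict total order _<_ on V(G) used
-- to represent each unordered edge {u , v} once as (u , v) with u < v.

IsClique : (G : Graph) → List (V G) → Set
IsClique G C = ∀ {x y} → x ∈ C → y ∈ C → x ≢ y → _~_ G x y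

Edge : (G : Graph) → (V G → V G → Set) → Set
Edge G _<_ = Σ (V G × V G) λ { (u , v) → (u < v) × _~_ G u v }

InCommonClique : (G : Graph) (_<_ : V G → V G → Set) → Edge G _<_ → Edge G _<_ → Set
InCommonClique G _<_ ((u , v) , _) ((x , y) , _) =
  ∃ λ (C : List (V G)) → IsClique G C × u ∈ C × v ∈ C × x ∈ C × y ∈ C

Ke : (G : Graph) → (V G → V G → Set) → Graph
Ke G _<_ = record
  { V   = Edge G _<_
  ; _~_ = λ e f → (e ≢ f) × InCommonClique G _<_ e f
  }

KeCp : ℕ → Graph
KeCp n = Ke (cp n) _<cp_

-- GF(2) arithmetic with propositional entries:
-- OddCount P xs  means  Σ_{x ∈ xs} [P x]  ≡ 1 (mod 2).

data OddCount {A : Set} (P : A → Set) : List A → Set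
data EvenCount {A : Set} (P : A → Set) : List A → Set

data OddCount {A} P where
  odd-yes : ∀ {x xs} → P x → EvenCount P xs → OddCount P (x ∷ xs)
  odd-no  : ∀ {x xs} → ¬ P x → OddCount P xs → OddCount P (x ∷ xs)

data EvenCount {A} P where
  even-[]  : EvenCount P []
  even-yes : ∀ {x xs} → P x → OddCount P xs → EvenCount P (x ∷ xs)
  even-no  : ∀ {x xs} → ¬ P x → EvenCount P xs → EvenCount P (x ∷ xs)

-- For X ⊆ V(G), A_G[X , V∖X] is the GF(2) matrix with rows
-- indexed by X and columns by V ∖ X.  A list R of distinct rows is
-- linearly independent over GF(2) iff no nonempty subfamily sums to the
-- zero vector, i.e. for every nonempty S ⊆ R some column y ∉ X has an odd
-- number of x ∈ S adjacent to y.

IndependentRows : (G : Graph) → List (V G) → List (V G) → Set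
IndependentRows G X R =
  Unique R × All (_∈ X) R ×
  (∀ S → S ⊆ R → S ≢ [] → ∃ λ y → (y ∉ X) × OddCount (λ x → _~_ G x y) S)

CutRankAtLeast : (G : Graph) → List (V G) → ℕ → Set
CutRankAtLeast G X r = ∃ λ R → (length R ≡ r) × IndependentRows G X R

CutRankAtMost : (G : Graph) → List (V G) → ℕ → Set
CutRankAtMost G X k = ¬ CutRankAtLeast G X (suc k)

-- Subcubic trees with leaves labelled by V.  Every tree with at least
-- two nodes is represented as rooted at one of its leaves (labelled v),
-- whose unique neighbour is the root of a subtree in which every node has
-- at most two children (leaf = degree 1, one child = degree 2, two
-- children = degree 3).

data SubTree (A : Set) : Set where
  leaf : A → SubTree A
  one  : SubTree A → SubTree A
  two  : SubTree A → SubTree A → SubTree A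

data Layout (A : Set) : Set where
  empty  : Layout A                      -- only used when V is empty
  single : A → Layout A
  rooted : A → SubTree A → Layout A

leavesST : ∀ {A} → SubTree A → List A
leavesST (leaf a)  = a ∷ []
leavesST (one t)   = leavesST t
leavesST (two s t) = leavesST s ++ leavesST t

leaves : ∀ {A} → Layout A → List A
leaves empty        = []
leaves (single a)   = a ∷ []
leaves (rooted a t) = a ∷ leavesST t

data _≼_ {A : Set} : SubTree A → SubTree A → Set where
  here  : ∀ {t} → t ≼ t
  under : ∀ {s t} → s ≼ t → s ≼ one t
  left  : ∀ {s t u} → s ≼ t → s ≼ two t u
  right : ∀ {s t u} → s ≼ u → s ≼ two t u

-- X is one side of the bipartition of leaves induced by some tree edge:
-- every edge of the tree is the edge from the root of some subtree s to
-- its parent, and its leaf bipartition is (leaves s , rest).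
IsCut : ∀ {A} → Layout A → List A → Set
IsCut empty        X = ⊥
IsCut (single a)   X = ⊥
IsCut (rooted a t) X = ∃ λ s → (s ≼ t) × (X ≡ leavesST s)

IsDecomposition : (G : Graph) → Layout (V G) → Set
IsDecomposition G L = Unique (leaves L) × (∀ v → v ∈ leaves L)

RankwidthAtMost : Graph → ℕ → Set
RankwidthAtMost G k =
  ∃ λ (L : Layout (V G)) → IsDecomposition G L ×
    (∀ X → IsCut L X → CutRankAtMost G X k)

module Submission where

-- In K_e(cp(2n)) the edges from the r-th index of the left half to the c-th
-- index of the right half form an n × n grid of cells; taking the Boolean
-- copy of each endpoint from a two-colouring κ of the other coordinate, two
-- cells lie in a common clique unless they share a row (column) and differ in
-- column (row) colour.  Every subcubic layout has a cut X carrying between a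
-- third and two thirds of the cells (BalancedCut).  Across such a cut, all
-- columns or at least n/3 rows meet both X and its complement; 2k+3 such
-- lines of one colour yield, on each line, a cell inside X and a differently
-- coloured cell outside, i.e. a bordered identity-complement submatrix that
-- is nonsingular over GF(2) (BorderedComplement, LinesToRank).  Hence the
-- cut-rank exceeds k when n ≥ 3(2k+3).

open import Defs
open import Level using (0ℓ)
open import Function.Base using (_∘_)
open import Data.Bool using (Bool; true; false)
import Data.Bool.Properties as Boolₚ
open import Data.Unit using (tt)
open import Data.Empty using (⊥; ⊥-elim)
open import Data.Nat using (ℕ; zero; suc; _+_; _*_; _≤_; _<_; z≤n; s≤s; _≤?_; _<?_)
open import Data.Nat.Properties
open import Data.Nat.Solver using (module +-*-Solver)
open import Data.Fin using (Fin; zero; suc; toℕ; _↑ˡ_; _↑ʳ_)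
import Data.Fin.Properties as Finₚ
open import Data.Product using (∃; _×_; _,_; proj₁; proj₂)
open import Data.Product.Properties using (≡-dec)
open import Data.Sum using (_⊎_; inj₁; inj₂)
open import Data.List using (List; []; _∷_; _++_; map; length; take)
open import Data.List.Properties using (length-map; length-take)
open import Data.List.Relation.Unary.All as All using (All; []; _∷_)
import Data.List.Relation.Unary.All.Properties as Allₚ
open import Data.List.Relation.Unary.Any using (here; there)
open import Data.List.Relation.Unary.AllPairs using (AllPairs; []; _∷_)
open import Data.List.Relation.Unary.Unique.Propositional using (Unique)
import Data.List.Relation.Unary.Unique.Propositional.Properties as Uniqueₚ
open import Data.List.Membership.Propositional using (_∈_; _∉_)
open import Data.List.Membership.Propositional.Properties using (∈-map⁻; ∈-++⁺ˡ; ∈-++⁺ʳ; ∈-++⁻)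
open import Data.List.Relation.Binary.Sublist.Propositional using (_⊆_; []; _∷_; _∷ʳ_; ⊆-refl)
open import Data.List.Relation.Binary.Sublist.Propositional.Properties
  using (All-resp-⊆; Any-resp-⊆; ++⁺ˡ; ++⁺ʳ; take-⊆)
open import Relation.Nullary using (¬_; Dec; yes; no; _because_)
open import Relation.Nullary.Decidable using (_×-dec_; ¬?)
open import Relation.Unary using (Pred; Decidable)
open import Relation.Binary.Definitions using (DecidableEquality; Irrelevant; Symmetric; Reflexive)
open import Relation.Binary.PropositionalEquality
open import Axiom.UniquenessOfIdentityProofs using (module Decidable⇒UIP)
open import Algebra.Properties.CommutativeMonoid.Sum +-0-commutativeMonoid
  using (sum; ∑-distrib-+; sum-cong-≗)
open +-*-Solver

𝟙 : {A : Set} → Dec A → ℕ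
𝟙 (true  because _) = 1
𝟙 (false because _) = 0

𝟙≤1 : {A : Set} (d : Dec A) → 𝟙 d ≤ 1
𝟙≤1 (true  because _) = s≤s z≤n
𝟙≤1 (false because _) = z≤n

count : ∀ {n} {P : Pred (Fin n) 0ℓ} → Decidable P → ℕ
count P? = sum (λ i → 𝟙 (P? i))

sum-mono-≤ : ∀ {n} {f g : Fin n → ℕ} → (∀ i → f i ≤ g i) → sum f ≤ sum g
sum-mono-≤ {zero}  f≤g = z≤n
sum-mono-≤ {suc n} f≤g = +-mono-≤ (f≤g zero) (sum-mono-≤ (f≤g ∘ suc))

sum-const : ∀ n c → sum {n} (λ _ → c) ≡ n * c
sum-const zero    c = refl
sum-const (suc n) c = cong (c +_) (sum-const n c)

sum-*ˡ : ∀ {n} c (f : Fin n → ℕ) → sum (λ i → c * f i) ≡ c * sum f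
sum-*ˡ {zero}  c f = sym (*-zeroʳ c)
sum-*ˡ {suc n} c f = begin
  c * f zero + sum (λ i → c * f (suc i)) ≡⟨ cong (c * f zero +_) (sum-*ˡ c (f ∘ suc)) ⟩
  c * f zero + c * sum (f ∘ suc)         ≡⟨ *-distribˡ-+ c (f zero) _ ⟨
  c * (f zero + sum (f ∘ suc))           ∎
  where open ≡-Reasoning

count≤n : ∀ {n} {P : Pred (Fin n) 0ℓ} (P? : Decidable P) → count P? ≤ n
count≤n {n} P? = ≤-trans (sum-mono-≤ (𝟙≤1 ∘ P?)) (≤-reflexive (trans (sum-const n 1) (*-identityʳ n)))

count-none : ∀ {n} {P : Pred (Fin n) 0ℓ} (P? : Decidable P) → (∀ i → ¬ P i) → count P? ≡ 0
count-none {zero}  P? none = refl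
count-none {suc n} P? none with P? zero
... | yes p = ⊥-elim (none zero p)
... | no _  = count-none (P? ∘ suc) (none ∘ suc)

count-all : ∀ {n} {P : Pred (Fin n) 0ℓ} (P? : Decidable P) → (∀ i → P i) → count P? ≡ n
count-all {zero}  P? all = refl
count-all {suc n} P? all with P? zero
... | yes _ = cong suc (count-all (P? ∘ suc) (all ∘ suc))
... | no ¬p = ⊥-elim (¬p (all zero))

count≡0⇒none : ∀ {n} {P : Pred (Fin n) 0ℓ} (P? : Decidable P) → count P? ≡ 0 → ∀ i → ¬ P i
count≡0⇒none {suc n} P? c≡0 i with P? zero
count≡0⇒none {suc n} P? c≡0 i       | yes _ = ⊥-elim (1+n≢0 c≡0)
count≡0⇒none {suc n} P? c≡0 zero    | no ¬p = ¬p
count≡0⇒none {suc n} P? c≡0 (suc i) | no _  = count≡0⇒none (P? ∘ suc) c≡0 i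

count≡n⇒all : ∀ {n} {P : Pred (Fin n) 0ℓ} (P? : Decidable P) → count P? ≡ n → ∀ i → P i
count≡n⇒all {suc n} P? c≡n i with P? zero
count≡n⇒all {suc n} P? c≡n zero    | yes p = p
count≡n⇒all {suc n} P? c≡n (suc i) | yes _ = count≡n⇒all (P? ∘ suc) (suc-injective c≡n) i
count≡n⇒all {suc n} P? c≡n i       | no _  =
  ⊥-elim (1+n≰n (subst (_≤ n) c≡n (count≤n (P? ∘ suc))))

count>0⇒some : ∀ {n} {P : Pred (Fin n) 0ℓ} (P? : Decidable P) → 0 < count P? → ∃ P
count>0⇒some {suc n} P? pos with P? zero
... | yes p = zero , p
... | no _  = let i , p = count>0⇒some (P? ∘ suc) pos in suc i , p

count<n⇒someNot : ∀ {n} {P : Pred (Fin n) 0ℓ} (P? : Decidable P) → count P? < n → ∃ (¬_ ∘ P)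
count<n⇒someNot {suc n} P? lt with P? zero
... | no ¬p = zero , ¬p
... | yes _ = let i , ¬p = count<n⇒someNot (P? ∘ suc) (≤-pred lt) in suc i , ¬p

count-atMostOne : ∀ {n} {P : Pred (Fin n) 0ℓ} (P? : Decidable P) → (∀ {i j} → P i → P j → i ≡ j) →
                  count P? ≤ 1
count-atMostOne {zero}  P? once = z≤n
count-atMostOne {suc n} P? once with P? zero
... | yes p = s≤s (≤-reflexive (count-none (P? ∘ suc) (λ i q → Finₚ.0≢1+n (once p q))))
... | no _  = count-atMostOne (P? ∘ suc) (λ p q → Finₚ.suc-injective (once p q))

enumerate : ∀ {n} {P : Pred (Fin n) 0ℓ} (P? : Decidable P) →
            ∃ λ is → Unique is × All P is × length is ≡ count P?
enumerate {zero}  P? = [] , [] , [] , refl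
enumerate {suc n} P? with enumerate (P? ∘ suc) | P? zero
... | is , uniq , all , len | yes p =
  zero ∷ map suc is ,
  Allₚ.map⁺ (All.tabulate (λ _ ())) ∷ Uniqueₚ.map⁺ Finₚ.suc-injective uniq ,
  p ∷ Allₚ.map⁺ all ,
  cong suc (trans (length-map suc is) len)
... | is , uniq , all , len | no _ =
  map suc is , Uniqueₚ.map⁺ Finₚ.suc-injective uniq , Allₚ.map⁺ all , trans (length-map suc is) len

coloured : ∀ {n} {P : Pred (Fin n) 0ℓ} → Decidable P → (c : Fin n → Bool) (b : Bool) →
           Decidable (λ i → P i × c i ≡ b)
coloured P? c b i = P? i ×-dec c i Boolₚ.≟ b

count-split : ∀ {n} {P : Pred (Fin n) 0ℓ} (P? : Decidable P) (c : Fin n → Bool) →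
              count P? ≡ count (coloured P? c true) + count (coloured P? c false)
count-split P? c = trans (sum-cong-≗ pointwise)
                         (∑-distrib-+ (λ i → 𝟙 (coloured P? c true i)) (λ i → 𝟙 (coloured P? c false i)))
  where
  pointwise : ∀ i → 𝟙 (P? i) ≡ 𝟙 (coloured P? c true i) + 𝟙 (coloured P? c false i)
  pointwise i with P? i | c i
  ... | yes _ | true  = refl
  ... | yes _ | false = refl
  ... | no _  | true  = refl
  ... | no _  | false = refl

monochromatic-majority : ∀ {n} {P : Pred (Fin n) 0ℓ} (P? : Decidable P) (c : Fin n → Bool) k →
                         3 + (k + k) ≤ count P? → ∃ λ b → 2 + k ≤ count (coloured P? c b)
monochromatic-majority P? c k many
  with 2 + k ≤? count (coloured P? c true) | 2 + k ≤? count (coloured P? c false)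
... | yes enough | _          = true , enough
... | no _       | yes enough = false , enough
... | no few₁    | no few₂    = ⊥-elim (1+n≰n (begin
  3 + (k + k)                                               ≤⟨ many ⟩
  count P?                                                  ≡⟨ count-split P? c ⟩
  count (coloured P? c true) + count (coloured P? c false)  ≤⟨ +-mono-≤ (≤-pred (≰⇒> few₁)) (≤-pred (≰⇒> few₂)) ⟩
  suc k + suc k                                             ≡⟨ cong suc (+-suc k k) ⟩
  2 + (k + k)                                               ∎))
  where open ≤-Reasoning

choose : ∀ {n} {P : Pred (Fin n) 0ℓ} → Decidable P → Fin n → Fin n
choose P? d with Finₚ.any? P?
... | yes (i , _) = i
... | no _        = d

choose-spec : ∀ {n} {P : Pred (Fin n) 0ℓ} (P? : Decidable P) d → ∃ P → P (choose P? d)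
choose-spec P? d some with Finₚ.any? P?
... | yes (_ , p) = p
... | no none     = ⊥-elim (none some)

Unique-resp-⊆ : ∀ {A : Set} {xs ys : List A} → xs ⊆ ys → Unique ys → Unique xs
Unique-resp-⊆ []           uniq         = uniq
Unique-resp-⊆ (_ ∷ʳ sub)   (_ ∷ uniq)   = Unique-resp-⊆ sub uniq
Unique-resp-⊆ (refl ∷ sub) (x∉ ∷ uniq)  = All-resp-⊆ sub x∉ ∷ Unique-resp-⊆ sub uniq

Unique-++ˡ : ∀ {A : Set} (xs : List A) {ys} → Unique (xs ++ ys) → Unique xs
Unique-++ˡ xs {ys} = Unique-resp-⊆ (++⁺ʳ ys ⊆-refl)

Unique-++ʳ : ∀ {A : Set} (xs : List A) {ys} → Unique (xs ++ ys) → Unique ys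
Unique-++ʳ xs = Unique-resp-⊆ (++⁺ˡ xs ⊆-refl)

Unique-++⇒disjoint : ∀ {A : Set} (xs : List A) {ys x} → Unique (xs ++ ys) → x ∈ xs → x ∉ ys
Unique-++⇒disjoint (_ ∷ xs) (x∉ ∷ _)   (here refl) x∈ys = All.lookup x∉ (∈-++⁺ʳ xs x∈ys) refl
Unique-++⇒disjoint (_ ∷ xs) (_ ∷ uniq) (there x∈)       = Unique-++⇒disjoint xs uniq x∈

AllPairs-lookup : ∀ {A : Set} {R : A → A → Set} → Symmetric R → Reflexive R →
                  ∀ {xs x y} → AllPairs R xs → x ∈ xs → y ∈ xs → R x y
AllPairs-lookup sym′ refl′ (_ ∷ _)   (here refl) (here refl) = refl′
AllPairs-lookup sym′ refl′ (Rx ∷ _)  (here refl) (there y∈) = All.lookup Rx y∈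
AllPairs-lookup sym′ refl′ (Rx ∷ _)  (there x∈) (here refl) = sym′ (All.lookup Rx x∈)
AllPairs-lookup sym′ refl′ (_ ∷ Rxs) (there x∈) (there y∈)  = AllPairs-lookup sym′ refl′ Rxs x∈ y∈

parity : ∀ {A : Set} {P : A → Set} {xs} → All P xs → EvenCount P xs ⊎ OddCount P xs
parity []       = inj₁ even-[]
parity (p ∷ ps) with parity ps
... | inj₁ even = inj₂ (odd-yes p even)
... | inj₂ odd  = inj₁ (even-yes p odd)

-- ... and it is the parity of the length, so it is the same for any other
-- predicate Q satisfied by every member.
module _ {A : Set} {P Q : A → Set} where
  even-transport : ∀ {xs} → All P xs → All Q xs → EvenCount P xs → EvenCount Q xs
  odd-transport  : ∀ {xs} → All P xs → All Q xs → OddCount P xs → OddCount Q xs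
  even-transport []       []       even-[]          = even-[]
  even-transport (_ ∷ ps) (q ∷ qs) (even-yes _ odd) = even-yes q (odd-transport ps qs odd)
  even-transport (p ∷ _)  _        (even-no ¬p _)   = ⊥-elim (¬p p)
  odd-transport  (_ ∷ ps) (q ∷ qs) (odd-yes _ even) = odd-yes q (even-transport ps qs even)
  odd-transport  (p ∷ _)  _        (odd-no ¬p _)    = ⊥-elim (¬p p)

-- The bordered complement of an identity matrix is nonsingular over GF(2).
-- Rows row ℓ ∈ X and columns col ℓ ∉ X (ℓ ∈ ls) with row ℓ' ~ col ℓ exactly
-- when row ℓ' ≠ row ℓ, plus a column "border" ∉ X adjacent to every row:
-- given a nonempty set S of rows with first member row ℓ, the border column
-- sees |S| rows and col ℓ sees |S| - 1, so one of them sees an odd number.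
module BorderedComplement (G : Graph) (X : List (V G)) {L : Set} (ls : List L)
  (row col : L → V G) (border : V G)
  (rows-unique  : Unique (map row ls))
  (row∈X        : ∀ {ℓ} → ℓ ∈ ls → row ℓ ∈ X)
  (col∉X        : ∀ {ℓ} → ℓ ∈ ls → col ℓ ∉ X)
  (border∉X     : border ∉ X)
  (diagonal     : ∀ {ℓ} → ℓ ∈ ls → ¬ _~_ G (row ℓ) (col ℓ))
  (off-diagonal : ∀ {ℓ ℓ'} → ℓ ∈ ls → ℓ' ∈ ls → row ℓ' ≢ row ℓ → _~_ G (row ℓ') (col ℓ))
  (border-adj   : ∀ {ℓ} → ℓ ∈ ls → _~_ G (row ℓ) border)
  where

  Rows : List (V G) → Set
  Rows S = ∀ {z} → z ∈ S → ∃ λ ℓ' → ℓ' ∈ ls × z ≡ row ℓ'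

  border-sees : ∀ {S} → Rows S → All (λ z → _~_ G z border) S
  border-sees origin = All.tabulate λ z∈ → sees (origin z∈)
    where
    sees : ∀ {z} → (∃ λ ℓ' → ℓ' ∈ ls × z ≡ row ℓ') → _~_ G z border
    sees (_ , ℓ'∈ , refl) = border-adj ℓ'∈

  col-sees : ∀ {ℓ S} → ℓ ∈ ls → Rows S → All (row ℓ ≢_) S → All (λ z → _~_ G z (col ℓ)) S
  col-sees {ℓ} ℓ∈ origin distinct = All.tabulate λ z∈ → sees (origin z∈) (All.lookup distinct z∈)
    where
    sees : ∀ {z} → (∃ λ ℓ' → ℓ' ∈ ls × z ≡ row ℓ') → row ℓ ≢ z → _~_ G z (col ℓ)
    sees (_ , ℓ'∈ , refl) ≢z = off-diagonal ℓ∈ ℓ'∈ (≢z ∘ sym)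

  odd-column : ∀ {ℓ S} → ℓ ∈ ls → Rows S → All (row ℓ ≢_) S →
               ∃ λ y → (y ∉ X) × OddCount (λ x → _~_ G x y) (row ℓ ∷ S)
  odd-column {ℓ} ℓ∈ origin distinct with parity (border-sees origin)
  ... | inj₁ even = border , border∉X , odd-yes (border-adj ℓ∈) even
  ... | inj₂ odd  = col ℓ , col∉X ℓ∈ ,
    odd-no (diagonal ℓ∈) (odd-transport (border-sees origin) (col-sees ℓ∈ origin distinct) odd)

  rows-independent : IndependentRows G X (map row ls)
  rows-independent = rows-unique , Allₚ.map⁺ (All.tabulate row∈X) , some-odd-column
    where
    some-odd-column : ∀ S → S ⊆ map row ls → S ≢ [] →
                      ∃ λ y → (y ∉ X) × OddCount (λ x → _~_ G x y) S
    some-odd-column []      _   nonempty = ⊥-elim (nonempty refl)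
    some-odd-column (x ∷ S) sub _
      with Unique-resp-⊆ sub rows-unique | ∈-map⁻ row (Any-resp-⊆ sub (here refl))
    ... | x∉S ∷ _ | ℓ , ℓ∈ , refl = odd-column ℓ∈ (λ z∈ → ∈-map⁻ row (Any-resp-⊆ sub (there z∈))) x∉S

≼-trans : ∀ {A : Set} {s u t : SubTree A} → s ≼ u → u ≼ t → s ≼ t
≼-trans s≼u here      = s≼u
≼-trans s≼u (under p) = under (≼-trans s≼u p)
≼-trans s≼u (left p)  = left (≼-trans s≼u p)
≼-trans s≼u (right p) = right (≼-trans s≼u p)

module BalancedCut {A : Set} (μ : List A → ℕ)
  (μ-++ : ∀ xs ys → Unique (xs ++ ys) → μ (xs ++ ys) ≡ μ xs + μ ys)
  (N c : ℕ) (μ-leaf : ∀ x → μ (x ∷ []) ≤ c) (leaves-light : 3 * c < 2 * N)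
  where

  Balanced : List A → Set
  Balanced X = N < 3 * μ X × 3 * μ X ≤ 2 * N

  BalancedBelow : SubTree A → Set
  BalancedBelow t = ∃ λ s → s ≼ t × Balanced (leavesST s)

  below-mono : ∀ {s t} → s ≼ t → BalancedBelow s → BalancedBelow t
  below-mono s≼t (s' , s'≼s , balanced) = s' , ≼-trans s'≼s s≼t , balanced

  heavier-part : ∀ a b → 2 * N < 3 * (a + b) → a ≤ b → N < 3 * b
  heavier-part a b heavy a≤b = *-cancelˡ-< 2 N (3 * b) (begin-strict
    2 * N       <⟨ heavy ⟩
    3 * (a + b) ≤⟨ *-monoʳ-≤ 3 (+-monoˡ-≤ b a≤b) ⟩
    3 * (b + b) ≡⟨ solve 1 (λ b → con 3 :* (b :+ b) := con 2 :* (con 3 :* b)) refl b ⟩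
    2 * (3 * b) ∎)
    where open ≤-Reasoning

  -- a subtree heavier than 2N/3 contains a balanced subtree: walk down
  -- towards a heavy child while there is one, else stop at the heavier child
  descend : ∀ s → Unique (leavesST s) → 2 * N < 3 * μ (leavesST s) → BalancedBelow s
  descend-two : ∀ s u → Unique (leavesST s ++ leavesST u) →
                2 * N < 3 * (μ (leavesST s) + μ (leavesST u)) → BalancedBelow (two s u)

  descend (leaf x) _ heavy =
    ⊥-elim (<-irrefl refl (<-trans leaves-light (<-≤-trans heavy (*-monoʳ-≤ 3 (μ-leaf x)))))
  descend (one s) uniq heavy = below-mono (under here) (descend s uniq heavy)
  descend (two s u) uniq heavy =
    descend-two s u uniq (subst (λ w → 2 * N < 3 * w) (μ-++ (leavesST s) (leavesST u) uniq) heavy)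

  descend-two s u uniq heavy
    with 2 * N <? 3 * μ (leavesST s) | 2 * N <? 3 * μ (leavesST u)
  ... | yes heavy-s | _ = below-mono (left here) (descend s (Unique-++ˡ (leavesST s) uniq) heavy-s)
  ... | no _ | yes heavy-u = below-mono (right here) (descend u (Unique-++ʳ (leavesST s) uniq) heavy-u)
  ... | no light-s | no light-u with ≤-total (μ (leavesST s)) (μ (leavesST u))
  ... | inj₁ s≤u = u , right here , heavier-part _ _ heavy s≤u , ≮⇒≥ light-u
  ... | inj₂ u≤s = s , left here ,
        heavier-part _ _ (subst (λ w → 2 * N < 3 * w) (+-comm (μ (leavesST s)) _) heavy) u≤s ,
        ≮⇒≥ light-s

  -- if all but one leaf of a tree lies in t, some subtree of t is balanced
  balanced-subtree : ∀ t → Unique (leavesST t) → N ≤ μ (leavesST t) + c → BalancedBelow t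
  balanced-subtree t uniq almost-all with 2 * N <? 3 * μ (leavesST t)
  ... | yes heavy = descend t uniq heavy
  ... | no light  = t , here , +-cancelʳ-< (2 * N) N (3 * w) third , ≮⇒≥ light
    where
    w : ℕ
    w = μ (leavesST t)
    third : N + 2 * N < 3 * w + 2 * N
    third = begin-strict
      3 * N         ≤⟨ *-monoʳ-≤ 3 almost-all ⟩
      3 * (w + c)   ≡⟨ *-distribˡ-+ 3 w c ⟩
      3 * w + 3 * c <⟨ +-monoʳ-< (3 * w) leaves-light ⟩
      3 * w + 2 * N ∎
      where open ≤-Reasoning

module LinesToRank (G : Graph) (_≟_ : DecidableEquality (V G)) {m p : ℕ}
  (line : Fin m → Fin p → V G)
  (lineColour : Fin m → Bool) (colour : Fin p → Bool)
  (otherColour    : ∀ b → ∃ λ a → colour a ≢ b)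
  (line-injective : ∀ {ℓ ℓ' a b} → line ℓ a ≡ line ℓ' b → ℓ ≡ ℓ')
  (within-line    : ∀ ℓ {a b} → colour a ≢ colour b → ¬ _~_ G (line ℓ a) (line ℓ b))
  (across-lines   : ∀ {ℓ ℓ' a b} → ℓ ≢ ℓ' → lineColour ℓ ≡ lineColour ℓ' →
                    line ℓ a ≢ line ℓ' b → _~_ G (line ℓ a) (line ℓ' b))
  (X : List (V G))
  where

  open import Data.List.Membership.DecPropositional _≟_ using (_∈?_)

  Bichromatic : Fin m → Set
  Bichromatic ℓ = (∃ λ a → line ℓ a ∈ X) × (∃ λ b → line ℓ b ∉ X)

  Separating : Fin m → Fin p × Fin p → Set
  Separating ℓ (a , b) = line ℓ a ∈ X × line ℓ b ∉ X × colour a ≢ colour b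

  recolour : (ℓ : Fin m) (a b c : Fin p) → Dec (colour a ≡ colour b) → Dec (line ℓ c ∈ X) → Fin p × Fin p
  recolour ℓ a b c (no _)  _       = a , b
  recolour ℓ a b c (yes _) (yes _) = c , b
  recolour ℓ a b c (yes _) (no _)  = a , c

  recolour-separates : ∀ ℓ a b c → line ℓ a ∈ X → line ℓ b ∉ X → colour c ≢ colour a →
    (a≟b : Dec (colour a ≡ colour b)) (c∈? : Dec (line ℓ c ∈ X)) → Separating ℓ (recolour ℓ a b c a≟b c∈?)
  recolour-separates ℓ a b c a∈ b∉ c≢a (no a≢b)  _        = a∈ , b∉ , a≢b
  recolour-separates ℓ a b c a∈ b∉ c≢a (yes a≡b) (yes c∈) = c∈ , b∉ , λ c≡b → c≢a (trans c≡b (sym a≡b))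
  recolour-separates ℓ a b c a∈ b∉ c≢a (yes _)   (no c∉)  = a∈ , c∉ , c≢a ∘ sym

  default : Fin p
  default = proj₁ (otherColour true)

  first-in first-out other : Fin m → Fin p
  first-in  ℓ = choose (λ a → line ℓ a ∈? X) default
  first-out ℓ = choose (λ b → ¬? (line ℓ b ∈? X)) default
  other     ℓ = proj₁ (otherColour (colour (first-in ℓ)))

  separation : Fin m → Fin p × Fin p
  separation ℓ = recolour ℓ (first-in ℓ) (first-out ℓ) (other ℓ)
                   (colour (first-in ℓ) Boolₚ.≟ colour (first-out ℓ)) (line ℓ (other ℓ) ∈? X)

  separation-separates : ∀ ℓ → Bichromatic ℓ → Separating ℓ (separation ℓ)
  separation-separates ℓ (meets , leaves) =
    recolour-separates ℓ (first-in ℓ) (first-out ℓ) (other ℓ)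
      (choose-spec (λ a → line ℓ a ∈? X) default meets)
      (choose-spec (λ b → ¬? (line ℓ b ∈? X)) default leaves)
      (proj₂ (otherColour (colour (first-in ℓ))))
      (colour (first-in ℓ) Boolₚ.≟ colour (first-out ℓ)) (line ℓ (other ℓ) ∈? X)

  inside outside : Fin m → V G
  inside  ℓ = line ℓ (proj₁ (separation ℓ))
  outside ℓ = line ℓ (proj₂ (separation ℓ))

  -- Lines ℓ₀ ∷ ls, distinct, bichromatic and of a common colour, with |ls| = k+1:
  -- the rows inside ℓ (ℓ ∈ ls) against the columns outside ℓ and outside ℓ₀
  -- form a bordered identity complement, so the cut-rank is at least k+1.
  rank-from-monochromatic : ∀ k b ℓ₀ ls → Unique (ℓ₀ ∷ ls) →
    All (λ ℓ → Bichromatic ℓ × lineColour ℓ ≡ b) (ℓ₀ ∷ ls) → length ls ≡ suc k →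
    CutRankAtLeast G X (suc k)
  rank-from-monochromatic k b ℓ₀ ls (ℓ₀∉ls ∷ uniq) ((bi₀ , col₀) ∷ good) len =
    map inside ls , trans (length-map inside ls) len , rows-independent
    where
    separates : ∀ {ℓ} → ℓ ∈ ls → Separating ℓ (separation ℓ)
    separates ℓ∈ = separation-separates _ (proj₁ (All.lookup good ℓ∈))
    same-colour : ∀ {ℓ ℓ'} → ℓ ∈ ls → ℓ' ∈ ls → lineColour ℓ ≡ lineColour ℓ'
    same-colour ℓ∈ ℓ'∈ = trans (proj₂ (All.lookup good ℓ∈)) (sym (proj₂ (All.lookup good ℓ'∈)))
    separates₀ : Separating ℓ₀ (separation ℓ₀)
    separates₀ = separation-separates ℓ₀ bi₀
    in≢out : ∀ {ℓ ℓ'} → inside ℓ' ∈ X → outside ℓ ∉ X → inside ℓ' ≢ outside ℓ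
    in≢out in∈ out∉ eq = out∉ (subst (_∈ X) eq in∈)
    open BorderedComplement G X ls inside outside (outside ℓ₀)
      (Uniqueₚ.map⁺ line-injective uniq)
      (proj₁ ∘ separates)
      (proj₁ ∘ proj₂ ∘ separates)
      (proj₁ (proj₂ separates₀))
      (λ ℓ∈ → within-line _ (proj₂ (proj₂ (separates ℓ∈))))
      (λ ℓ∈ ℓ'∈ rows≢ → across-lines (rows≢ ∘ cong inside) (same-colour ℓ'∈ ℓ∈)
         (in≢out (proj₁ (separates ℓ'∈)) (proj₁ (proj₂ (separates ℓ∈)))))
      (λ ℓ∈ → across-lines (λ ℓ≡ℓ₀ → All.lookup ℓ₀∉ls ℓ∈ (sym ℓ≡ℓ₀))
         (trans (proj₂ (All.lookup good ℓ∈)) (sym col₀))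
         (in≢out (proj₁ (separates ℓ∈)) (proj₁ (proj₂ separates₀))))

  rank-from-lines : ∀ k {Q : Pred (Fin m) 0ℓ} (Q? : Decidable Q) → (∀ {ℓ} → Q ℓ → Bichromatic ℓ) →
                    3 + (k + k) ≤ count Q? → CutRankAtLeast G X (suc k)
  rank-from-lines k Q? bichromatic many with monochromatic-majority Q? lineColour k many
  ... | b , enough with enumerate (coloured Q? lineColour b)
  ... | [] , _ , _ , len = ⊥-elim (1+n≢0 (n≤0⇒n≡0 (≤-trans enough (≤-reflexive (sym len)))))
  ... | ℓ₀ ∷ ls , uniq , good , len =
    rank-from-monochromatic k b ℓ₀ (take (suc k) ls)
      (Unique-resp-⊆ shorten uniq)
      (All-resp-⊆ shorten (All.map (λ (q , col) → bichromatic q , col) good))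
      (trans (length-take (suc k) ls) (m≤n⇒m⊓n≡m (≤-pred (≤-trans enough (≤-reflexive (sym len))))))
    where
    shorten : ℓ₀ ∷ take (suc k) ls ⊆ ℓ₀ ∷ ls
    shorten = refl ∷ take-⊆ (suc k) ls

edge-≟ : (G : Graph) {_<_ : V G → V G → Set} → DecidableEquality (V G) →
         Irrelevant _<_ → Irrelevant (_~_ G) → DecidableEquality (Edge G _<_)
edge-≟ G _≟V_ <-irrelevant′ ~-irrelevant ((u , v) , u<v , u~v) ((x , y) , x<y , x~y)
  with ≡-dec _≟V_ _≟V_ (u , v) (x , y)
... | no uv≢xy = no (uv≢xy ∘ cong proj₁)
... | yes refl = yes (cong ((u , v) ,_) (cong₂ _,_ (<-irrelevant′ u<v x<y) (~-irrelevant u~v x~y)))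

<cp-irrelevant : ∀ {n} → Irrelevant (_<cp_ {n})
<cp-irrelevant (inj₁ p) (inj₁ q)           = cong inj₁ (<-irrelevant p q)
<cp-irrelevant (inj₁ p) (inj₂ (refl , _))  = ⊥-elim (<-irrefl refl p)
<cp-irrelevant (inj₂ (refl , _)) (inj₁ q)  = ⊥-elim (<-irrefl refl q)
<cp-irrelevant (inj₂ (i≡j , a≡f , b≡t)) (inj₂ (i≡j′ , a≡f′ , b≡t′)) =
  cong inj₂ (cong₂ _,_ (Decidable⇒UIP.≡-irrelevant Finₚ._≟_ i≡j i≡j′)
                       (cong₂ _,_ (Decidable⇒UIP.≡-irrelevant Boolₚ._≟_ a≡f a≡f′)
                                  (Decidable⇒UIP.≡-irrelevant Boolₚ._≟_ b≡t b≡t′)))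

KeCp-≟ : ∀ n → DecidableEquality (V (KeCp n))
KeCp-≟ n = edge-≟ (cp n) (≡-dec Finₚ._≟_ Boolₚ._≟_) <cp-irrelevant Boolₚ.T-irrelevant

Compatible : ∀ {n} → V (cp n) → V (cp n) → Set
Compatible (i , a) (j , b) = i ≡ j → a ≡ b

compatible-adjacent : ∀ {n} {u v : V (cp n)} → Compatible u v → u ≢ v → _~_ (cp n) u v
compatible-adjacent {u = i , a} {j , b} compat u≢v with i Finₚ.≟ j
... | yes refl = u≢v (cong (i ,_) (compat refl))
... | no _     = tt

same-index-nonadjacent : ∀ {n} (i : Fin n) {a b} → ¬ _~_ (cp n) (i , a) (i , b)
same-index-nonadjacent i adj with i Finₚ.≟ i
... | yes _ = adj
... | no i≢i = i≢i refl

compatible-clique : ∀ {n} {C : List (V (cp n))} → AllPairs Compatible C → IsClique (cp n) C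
compatible-clique pairs x∈ y∈ =
  compatible-adjacent (AllPairs-lookup (λ h → sym ∘ h ∘ sym) (λ _ → refl) pairs x∈ y∈)

-- The n × n grid in K_e(cp(2n)), for n = m + 2.  Cell (r , c) is the edge
-- from (leftHalf r , κ c) to (rightHalf c , κ r), where leftHalf/rightHalf
-- embed Fin n as the two halves of the indices of cp(n + n), and the
-- colouring κ marks index 0.
module Grid (m : ℕ) where

  n : ℕ
  n = 2 + m

  G : Graph
  G = KeCp (n + n)

  Adj : V G → V G → Set
  Adj = _~_ G

  κ : Fin n → Bool
  κ zero    = true
  κ (suc _) = false

  otherColour : ∀ b → ∃ λ a → κ a ≢ b
  otherColour true  = suc zero , λ ()
  otherColour false = zero , λ ()

  leftHalf rightHalf : Fin n → Fin (n + n)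
  leftHalf  r = r ↑ˡ n
  rightHalf c = n ↑ʳ c

  leftHalf-injective : ∀ {r r'} → leftHalf r ≡ leftHalf r' → r ≡ r'
  leftHalf-injective = Finₚ.↑ˡ-injective n _ _

  rightHalf-injective : ∀ {c c'} → rightHalf c ≡ rightHalf c' → c ≡ c'
  rightHalf-injective = Finₚ.↑ʳ-injective n _ _

  leftHalf<rightHalf : ∀ r c → toℕ (leftHalf r) < toℕ (rightHalf c)
  leftHalf<rightHalf r c rewrite Finₚ.toℕ-↑ˡ r n | Finₚ.toℕ-↑ʳ n c = ≤-trans (Finₚ.toℕ<n r) (m≤m+n n (toℕ c))

  leftHalf≢rightHalf : ∀ r c → leftHalf r ≢ rightHalf c
  leftHalf≢rightHalf r c eq = <⇒≢ (leftHalf<rightHalf r c) (cong toℕ eq)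

  leftEnd rightEnd : Fin n → Fin n → V (cp (n + n))
  leftEnd  r c = leftHalf r , κ c
  rightEnd r c = rightHalf c , κ r

  halves-compatible : ∀ r c {a b} → Compatible (leftHalf r , a) (rightHalf c , b)
  halves-compatible r c eq = ⊥-elim (leftHalf≢rightHalf r c eq)

  halves-compatible′ : ∀ c r {a b} → Compatible (rightHalf c , a) (leftHalf r , b)
  halves-compatible′ c r eq = ⊥-elim (leftHalf≢rightHalf r c (sym eq))

  -- cells are used only through the four facts below, so their definition
  -- is kept opaque
  opaque
    cell : Fin n → Fin n → V G
    cell r c = (leftEnd r c , rightEnd r c) , inj₁ (leftHalf<rightHalf r c) ,
               compatible-adjacent {u = leftEnd r c} {rightEnd r c} (halves-compatible r c) (leftHalf≢rightHalf r c ∘ cong proj₁)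

    cell-injective : ∀ {r c r' c'} → cell r c ≡ cell r' c' → r ≡ r' × c ≡ c'
    cell-injective eq = leftHalf-injective  (cong (proj₁ ∘ proj₁ ∘ proj₁) eq) ,
                        rightHalf-injective (cong (proj₁ ∘ proj₂ ∘ proj₁) eq)

    -- two cells are in a common clique (their four endpoints) unless they share
    -- a row and differ in column colour, or share a column and differ in row colour
    cell-adjacent : ∀ {r c r' c'} → (r ≡ r' → κ c ≡ κ c') → (c ≡ c' → κ r ≡ κ r') →
                    cell r c ≢ cell r' c' → Adj (cell r c) (cell r' c')
    cell-adjacent {r} {c} {r'} {c'} same-row same-column distinct =
      distinct , _ , compatible-clique endpoints-compatible ,
      here refl , there (here refl) , there (there (here refl)) , there (there (there (here refl)))
      where
      endpoints-compatible : AllPairs Compatible (leftEnd r c ∷ rightEnd r c ∷ leftEnd r' c' ∷ rightEnd r' c' ∷ [])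
      endpoints-compatible =
        (halves-compatible r c ∷ (same-row ∘ leftHalf-injective) ∷ halves-compatible r c' ∷ []) ∷
        (halves-compatible′ c r' ∷ (same-column ∘ rightHalf-injective) ∷ []) ∷
        (halves-compatible r' c' ∷ []) ∷ [] ∷ []

    same-row-nonadjacent : ∀ r {c c'} → κ c ≢ κ c' → ¬ Adj (cell r c) (cell r c')
    same-row-nonadjacent r {c} {c'} κ≢ (_ , _ , clique , u∈ , _ , x∈ , _) =
      same-index-nonadjacent (leftHalf r) {κ c} {κ c'} (clique u∈ x∈ (κ≢ ∘ cong proj₂))

    same-column-nonadjacent : ∀ c {r r'} → κ r ≢ κ r' → ¬ Adj (cell r c) (cell r' c)
    same-column-nonadjacent c {r} {r'} κ≢ (_ , _ , clique , _ , v∈ , _ , y∈) =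
      same-index-nonadjacent (rightHalf c) {κ r} {κ r'} (clique v∈ y∈ (κ≢ ∘ cong proj₂))

  module Rows = LinesToRank G (KeCp-≟ (n + n)) cell κ κ otherColour
    (λ {r} {r'} {c} {c'} eq → proj₁ (cell-injective {r} {c} {r'} {c'} eq)) same-row-nonadjacent
    (λ ℓ≢ℓ' κ≡ → cell-adjacent (⊥-elim ∘ ℓ≢ℓ') (λ _ → κ≡))

  module Columns = LinesToRank G (KeCp-≟ (n + n)) (λ c r → cell r c) κ κ otherColour
    (λ {c} {c'} {r} {r'} eq → proj₂ (cell-injective {r} {c} {r'} {c'} eq)) same-column-nonadjacent
    (λ ℓ≢ℓ' κ≡ → cell-adjacent (λ _ → κ≡) (⊥-elim ∘ ℓ≢ℓ'))

  open import Data.List.Membership.DecPropositional (KeCp-≟ (n + n)) using (_∈?_)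

  row∈? : (X : List (V G)) (r : Fin n) → Decidable (λ c → cell r c ∈ X)
  row∈? X r c = cell r c ∈? X

  rowCount : List (V G) → Fin n → ℕ
  rowCount X r = count (row∈? X r)

  weight : List (V G) → ℕ
  weight X = sum (rowCount X)

  𝟙-++ : ∀ xs ys v → Unique (xs ++ ys) → 𝟙 (v ∈? xs ++ ys) ≡ 𝟙 (v ∈? xs) + 𝟙 (v ∈? ys)
  𝟙-++ xs ys v uniq with v ∈? xs | v ∈? ys | v ∈? xs ++ ys
  ... | yes v∈xs | yes v∈ys | _         = ⊥-elim (Unique-++⇒disjoint xs uniq v∈xs v∈ys)
  ... | yes _    | no _     | yes _     = refl
  ... | yes v∈xs | no _     | no v∉xys  = ⊥-elim (v∉xys (∈-++⁺ˡ v∈xs))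
  ... | no _     | yes _    | yes _     = refl
  ... | no _     | yes v∈ys | no v∉xys  = ⊥-elim (v∉xys (∈-++⁺ʳ xs v∈ys))
  ... | no _     | no _     | no _      = refl
  ... | no v∉xs  | no v∉ys  | yes v∈xys with ∈-++⁻ xs v∈xys
  ...   | inj₁ v∈xs = ⊥-elim (v∉xs v∈xs)
  ...   | inj₂ v∈ys = ⊥-elim (v∉ys v∈ys)

  weight-++ : ∀ xs ys → Unique (xs ++ ys) → weight (xs ++ ys) ≡ weight xs + weight ys
  weight-++ xs ys uniq =
    trans (sum-cong-≗ λ r → trans (sum-cong-≗ λ c → 𝟙-++ xs ys (cell r c) uniq)
                                    (∑-distrib-+ (λ c → 𝟙 (cell r c ∈? xs)) (λ c → 𝟙 (cell r c ∈? ys))))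
          (∑-distrib-+ (rowCount xs) (rowCount ys))

  -- a single edge is at most one cell of each row
  weight-singleton : ∀ e → weight (e ∷ []) ≤ n
  weight-singleton e = ≤-trans (sum-mono-≤ λ r → count-atMostOne (row∈? (e ∷ []) r) (once r))
                               (≤-reflexive (trans (sum-const n 1) (*-identityʳ n)))
    where
    once : ∀ r {c c'} → cell r c ∈ e ∷ [] → cell r c' ∈ e ∷ [] → c ≡ c'
    once r (here c≡e) (here c'≡e) = proj₂ (cell-injective (trans c≡e (sym c'≡e)))

  weight-full : ∀ X → (∀ e → e ∈ X) → weight X ≡ n * n
  weight-full X full = trans (sum-cong-≗ λ r → count-all (row∈? X r) (λ c → full (cell r c)))
                             (sum-const n n)

  weight-all-but-one : ∀ a X → Unique (a ∷ X) → (∀ e → e ∈ a ∷ X) → n * n ≤ weight X + n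
  weight-all-but-one a X uniq full = begin
    n * n                      ≡⟨ weight-full (a ∷ X) full ⟨
    weight (a ∷ [] ++ X)       ≡⟨ weight-++ (a ∷ []) X uniq ⟩
    weight (a ∷ []) + weight X ≤⟨ +-monoˡ-≤ (weight X) (weight-singleton a) ⟩
    n + weight X               ≡⟨ +-comm n (weight X) ⟩
    weight X + n               ∎
    where open ≤-Reasoning

  rows-meeting : ∀ X → n * n < 3 * weight X → n ≤ 3 * count (λ r → 0 <? rowCount X r)
  rows-meeting X heavy = <⇒≤ (*-cancelˡ-< n n (3 * C) (begin-strict
    n * n         <⟨ heavy ⟩
    3 * weight X  ≤⟨ *-monoʳ-≤ 3 bounded ⟩
    3 * (n * C)   ≡⟨ solve 2 (λ n C → con 3 :* (n :* C) := n :* (con 3 :* C)) refl n C ⟩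
    n * (3 * C)   ∎))
    where
    open ≤-Reasoning
    C : ℕ
    C = count (λ r → 0 <? rowCount X r)
    row-bound : ∀ r → rowCount X r ≤ n * 𝟙 (0 <? rowCount X r)
    row-bound r with 0 <? rowCount X r
    ... | yes _    = ≤-trans (count≤n (row∈? X r)) (≤-reflexive (sym (*-identityʳ n)))
    ... | no ¬meets = ≤-trans (≮⇒≥ ¬meets) z≤n
    bounded : weight X ≤ n * C
    bounded = ≤-trans (sum-mono-≤ row-bound) (≤-reflexive (sum-*ˡ n (λ r → 𝟙 (0 <? rowCount X r))))

  rows-leaving : ∀ X → 3 * weight X ≤ 2 * (n * n) → n ≤ 3 * count (λ r → rowCount X r <? n)
  rows-leaving X light = *-cancelˡ-≤ n (+-cancelʳ-≤ (2 * (n * n)) (n * n) (n * (3 * C)) (begin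
    n * n + 2 * (n * n)          ≤⟨ *-monoʳ-≤ 3 covered ⟩
    3 * (weight X + n * C)       ≡⟨ *-distribˡ-+ 3 (weight X) (n * C) ⟩
    3 * weight X + 3 * (n * C)   ≤⟨ +-monoˡ-≤ (3 * (n * C)) light ⟩
    2 * (n * n) + 3 * (n * C)    ≡⟨ solve 2 (λ n C → con 2 :* (n :* n) :+ con 3 :* (n :* C)
                                                   := n :* (con 3 :* C) :+ con 2 :* (n :* n)) refl n C ⟩
    n * (3 * C) + 2 * (n * n)    ∎))
    where
    open ≤-Reasoning
    C : ℕ
    C = count (λ r → rowCount X r <? n)
    row-bound : ∀ r → n ≤ rowCount X r + n * 𝟙 (rowCount X r <? n)
    row-bound r with rowCount X r <? n
    ... | yes _    = ≤-trans (≤-reflexive (sym (*-identityʳ n))) (m≤n+m (n * 1) (rowCount X r))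
    ... | no ¬less = ≤-trans (≮⇒≥ ¬less) (m≤m+n (rowCount X r) _)
    covered : n * n ≤ weight X + n * C
    covered = begin
      n * n                                        ≡⟨ sum-const n n ⟨
      sum {n} (λ _ → n)                            ≤⟨ sum-mono-≤ row-bound ⟩
      sum (λ r → rowCount X r + n * 𝟙 (rowCount X r <? n))
                                                   ≡⟨ ∑-distrib-+ (rowCount X) (λ r → n * 𝟙 (rowCount X r <? n)) ⟩
      weight X + sum (λ r → n * 𝟙 (rowCount X r <? n))
                                                   ≡⟨ cong (weight X +_) (sum-*ˡ n (λ r → 𝟙 (rowCount X r <? n))) ⟩
      weight X + n * C                             ∎

  at-least-a-third : ∀ k {C} → 3 * (3 + (k + k)) ≤ n → n ≤ 3 * C → 3 + (k + k) ≤ C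
  at-least-a-third k big n≤3C = *-cancelˡ-≤ 3 (≤-trans big n≤3C)

  -- A cut carrying between a third and two thirds of the cells has cut-rank
  -- above k once n ≥ 3(2k+3): if some row lies in X and some row outside,
  -- all columns are bichromatic; otherwise the rows meeting X (if no row
  -- lies in X) or the rows leaving X (if no row lies outside) are.
  balanced-rank : ∀ k X → 3 * (3 + (k + k)) ≤ n → n * n < 3 * weight X → 3 * weight X ≤ 2 * (n * n) →
                  CutRankAtLeast G X (suc k)
  balanced-rank k X big heavy light
    with Finₚ.any? (λ r → rowCount X r ≟ n) | Finₚ.any? (λ r → rowCount X r ≟ 0)
  ... | yes (full , f) | yes (vacant , e) =
    Columns.rank-from-lines X k (λ _ → yes tt)
      (λ {c} _ → (full , count≡n⇒all (row∈? X full) f c) ,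
                 (vacant , count≡0⇒none (row∈? X vacant) e c))
      (≤-trans (≤-trans (m≤n*m (3 + (k + k)) 3) big) (≤-reflexive (sym (count-all (λ _ → yes tt) (λ _ → tt)))))
  ... | no no-full | _ =
    Rows.rank-from-lines X k (λ r → 0 <? rowCount X r)
      (λ {r} meets → count>0⇒some (row∈? X r) meets ,
                     count<n⇒someNot (row∈? X r) (≤∧≢⇒< (count≤n (row∈? X r)) (no-full ∘ (r ,_))))
      (at-least-a-third k big (rows-meeting X heavy))
  ... | yes _ | no no-empty =
    Rows.rank-from-lines X k (λ r → rowCount X r <? n)
      (λ {r} leaves → count>0⇒some (row∈? X r) (n≢0⇒n>0 (no-empty ∘ (r ,_))) ,
                      count<n⇒someNot (row∈? X r) leaves)
      (at-least-a-third k big (rows-leaving X light))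

  -- a single edge weighs less than two thirds of all n² cells
  3n<2n² : 3 * n < 2 * (n * n)
  3n<2n² = subst (3 * n <_) (expand m) (m<m+n (3 * n) (s≤s z≤n))
    where
    expand : ∀ m → 3 * (2 + m) + (2 + 5 * m + 2 * (m * m)) ≡ 2 * ((2 + m) * (2 + m))
    expand = solve 1 (λ m → con 3 :* (con 2 :+ m) :+ (con 2 :+ con 5 :* m :+ con 2 :* (m :* m))
                            := con 2 :* ((con 2 :+ m) :* (con 2 :+ m))) refl

  open BalancedCut weight weight-++ (n * n) n weight-singleton 3n<2n² using (BalancedBelow; balanced-subtree)

  no-empty-layout : ¬ (∀ e → e ∈ leaves {V G} empty)
  no-empty-layout covers with covers (cell zero zero)
  ... | ()

  no-single-layout : ∀ a → ¬ (∀ e → e ∈ leaves (single a))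
  no-single-layout a covers with covers (cell zero zero) | covers (cell zero (suc zero))
  ... | here p | here q = Finₚ.0≢1+n (proj₂ (cell-injective (trans p (sym q))))

  -- In a layout rooted at the leaf a, the tree below a has a balanced subtree,
  -- whose leaves form a cut of rank above k once n ≥ 3(2k+3).
  rankwidth-exceeds : ∀ k → 3 * (3 + (k + k)) ≤ n → ¬ RankwidthAtMost G k
  rankwidth-exceeds k big (empty , (_ , covers) , _)    = no-empty-layout covers
  rankwidth-exceeds k big (single a , (_ , covers) , _) = no-single-layout a covers
  rankwidth-exceeds k big (rooted a t , (uniq , covers) , small-cuts) =
    large-cut (balanced-subtree t (Unique-++ʳ (a ∷ []) uniq) (weight-all-but-one a (leavesST t) uniq covers))
    where
    large-cut : BalancedBelow t → ⊥
    large-cut (s , s≼t , heavy , light) =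
      small-cuts (leavesST s) (s , s≼t , refl) (balanced-rank k (leavesST s) big heavy light)

mainTheorem2 : ¬ (∃ λ (k : ℕ) → ∀ (n : ℕ) → RankwidthAtMost (KeCp n) k)
mainTheorem2 (k , bounded) = Grid.rankwidth-exceeds m k (m≤n+m m 2) (bounded (Grid.n m + Grid.n m))
  where
  m : ℕ
  m = 3 * (3 + (k + k))
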